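{- Let $\mathcal{H}\subseteq 2^V$ be a hypergraph (with $\mathcal H\neq\emptyset$, $\emptyset\notin\mathcal H$ and $V=\bigcup_{H\in\mathcal H}H$). If $\mathcal{H}$ is a JM hypergraph, then $\mathcal{H}$ is connected.
   Context: Let $V=\{1,\dots,n\}$. A hypergraph is a family $\mathcal H\subseteq 2^V$ with $\mathcal H\neq\emptyset$, $\emptyset\notin\mathcal H$, $V=\bigcup_{H\in\mathcal H}H$. The game $NIM_{\mathcal H}$ is played on positions $x\in\mathbb{Z}_{\ge 0}^V$ ($x_i$ = number of stones in pile $i$); a move ($H$-move) $x\to x'$ chooses $H\in\mathcal H$ and goes to any $x'\in\mathbb Z_{\ge0}^V$ with $x'_i<x_i$ for $i\in H$ and $x'_i=x_i$ for $i\notin H$. Two players alternate; the player who cannot move loses. The Sprague–Grundy function is $\mathcal G_{\mathcal H}(x)=\mathrm{mex}\{\mathcal G_{\mathcal H}(x') : x\to x' \text{ a move}\}$, where $\mathrm{mex}(S)$ is the least nonnegative integer not in $S$. The height $h_{\mathcal H}(x)$ is the maximum number of consecutive moves that can be made starting from $x$. Let $e$ be the all-ones vector and define $m(x)=\min_{i\in V}x_i$, $y_{\mathcal H}(x)=h_{\mathcal H}(x-m(x)e)+1$, $v_{\mathcal H}(x)=\binom{y_{\mathcal H}(x)}{2}+\big((m(x)-\binom{y_{\mathcal H}(x)}{2}-1)\bmod y_{\mathcal H}(x)\big)$ (residue in $\{0,\dots,y_{\mathcal H}(x)-1\}$), and $f_{\mathcal H}(x)=h_{\mathcal H}(x)$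 if $m(x)\le\binom{y_{\mathcal H}(x)}{2}$, and $f_{\mathcal H}(x)=v_{\mathcal H}(x)$ otherwise. $\mathcal H$ is a JM hypergraph if $\mathcal G_{\mathcal H}(x)=f_{\mathcal H}(x)$ for all $x\in\mathbb Z_{\ge0}^V$. $\mathcal H$ is not connected if $V$ can be partitioned into two nonempty sets $V_1,V_2$ such that every hyperedge is contained in $V_1$ or in $V_2$; otherwise it is connected. -}

module Defs where

open import Data.Nat using (ℕ; zero; suc; _+_; _∸_; _⊔_; _⊓_; _≡ᵇ_; _≤ᵇ_)
open import Data.Nat.DivMod using (_%_)
open import Data.Nat.Combinatorics using (_C_)
open import Data.Bool using (Bool; true; false; if_then_else_)
open import Data.List using (List; []; _∷_; map; concatMap; foldr; length; downFrom)
open import Data.Bool.ListAction using (any)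
open import Data.List.Relation.Unary.All using (All)
open import Data.List.Relation.Unary.Any using (Any)
open import Data.Vec using (Vec; []; _∷_)
import Data.Vec as Vec
open import Data.Fin using (Fin)
open import Data.Fin.Subset using (Subset; Nonempty; ∁; _⊆_) renaming (_∈_ to _∈ₛ_)
open import Data.Product using (Σ; _×_)
open import Data.Sum using (_⊎_)
open import Relation.Nullary using (¬_)
open import Relation.Binary.PropositionalEquality using (_≡_; _≢_)

-- Vertex set V = Fin n; a hyperedge is a subset of V (Data.Fin.Subset);
-- a family of hyperedges is given as a list (duplicates are irrelevant).
Position : ℕ → Set
Position n = Vec ℕ n

IsHypergraph : {n : ℕ} → List (Subset n) → Set
IsHypergraph {n} ℋ = (ℋ ≢ []) × All Nonempty ℋ × ((i : Fin n) → Any (i ∈ₛ_) ℋ)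

edgeMoves : {n : ℕ} → Subset n → Position n → List (Position n)
edgeMoves [] [] = [] ∷ []
edgeMoves (true ∷ E) (a ∷ x) = concatMap (λ b → map (b ∷_) (edgeMoves E x)) (downFrom a)
edgeMoves (false ∷ E) (a ∷ x) = map (a ∷_) (edgeMoves E x)

moves : {n : ℕ} → List (Subset n) → Position n → List (Position n)
moves ℋ x = concatMap (λ E → edgeMoves E x) ℋ

elemℕ : ℕ → List ℕ → Bool
elemℕ k l = any (λ m → m ≡ᵇ k) l

mexAux : ℕ → ℕ → List ℕ → ℕ
mexAux zero k l = k
mexAux (suc f) k l = if elemℕ k l then mexAux f (suc k) l else k

mex : List ℕ → ℕ
mex l = mexAux (length l) 0 l

total : {n : ℕ} → Position n → ℕ
total = Vec.foldr _ _+_ 0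

-- Recursion with fuel; since every hyperedge is nonempty, each move
-- decreases the total number of stones, so fuel (total x + 1) suffices
-- and the fuelled values are the true Sprague–Grundy value / height.
sgFuel : {n : ℕ} → List (Subset n) → ℕ → Position n → ℕ
sgFuel ℋ zero x = 0
sgFuel ℋ (suc f) x = mex (map (sgFuel ℋ f) (moves ℋ x))

maxList : List ℕ → ℕ
maxList = foldr _⊔_ 0

heightFuel : {n : ℕ} → List (Subset n) → ℕ → Position n → ℕ
heightFuel ℋ zero x = 0
heightFuel ℋ (suc f) x with moves ℋ x
... | [] = 0
... | ms@(_ ∷ _) = suc (maxList (map (heightFuel ℋ f) ms))

SG : {n : ℕ} → List (Subset n) → Position n → ℕ
SG ℋ x = sgFuel ℋ (suc (total x)) x

height : {n : ℕ} → List (Subset n) → Position n → ℕ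
height ℋ x = heightFuel ℋ (suc (total x)) x

-- m(x) = min_i x_i  (n ≥ 1 for any hypergraph)
minPos : {n : ℕ} → Position n → ℕ
minPos [] = 0
minPos (a ∷ []) = a
minPos (a ∷ b ∷ v) = a ⊓ minPos (b ∷ v)

hRed : {n : ℕ} → List (Subset n) → Position n → ℕ
hRed ℋ x = height ℋ (Vec.map (_∸ minPos x) x)

yH : {n : ℕ} → List (Subset n) → Position n → ℕ
yH ℋ x = suc (hRed ℋ x)

-- v_ℋ(x) = C(y,2) + ((m - C(y,2) - 1) mod y); only used when m > C(y,2)
vH : {n : ℕ} → List (Subset n) → Position n → ℕ
vH ℋ x = (yH ℋ x C 2) + ((minPos x ∸ (yH ℋ x C 2) ∸ 1) % suc (hRed ℋ x))

fH : {n : ℕ} → List (Subset n) → Position n → ℕ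
fH ℋ x = if minPos x ≤ᵇ (yH ℋ x C 2) then height ℋ x else vH ℋ x

IsJM : {n : ℕ} → List (Subset n) → Set
IsJM {n} ℋ = (x : Position n) → SG ℋ x ≡ fH ℋ x

NotConnected : {n : ℕ} → List (Subset n) → Set
NotConnected {n} ℋ =
  Σ (Subset n) λ S → Nonempty S × Nonempty (∁ S) × All (λ E → E ⊆ S ⊎ E ⊆ ∁ S) ℋ

Connected : {n : ℕ} → List (Subset n) → Set
Connected ℋ = ¬ NotConnected ℋ

module Submission where

-- A JM hypergraph is connected.  Suppose V = S ⊎ ∁S with every edge inside S
-- or inside ∁S.  Two situations can occur, and in each we exhibit a position x
-- with 𝒢(x) ≠ f(x).
--
--  * Free vertex: there are edges E, F and a vertex k outside E ∪ F such that
--    every edge is disjoint from E or from F (this happens when some edge is a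
--    proper subset of its side).  At x = 1 on E ∪ F, 0 elsewhere, pile k stays
--    empty forever, so f = h at x and at all its options; every option still
--    admits a move by E or by F, so no option has 𝒢 = 0, i.e. 𝒢(x) = 0, while
--    f(x) = h(x) ≥ 1.
--  * Two blocks: the edges are exactly S and ∁S.  At x = 1 on S, 3 on ∁S one
--    has f(x) = h(x) ≥ 4, yet no option y has f(y) = 2, so 𝒢(x) ≤ 2.

open import Defs
open import Data.Nat using (ℕ; zero; suc; _+_; _∸_; _≤_; _<_; _≤ᵇ_; _≡ᵇ_; z≤n; s≤s)
open import Data.Nat.Properties
open import Data.Nat.Combinatorics using (_C_; nCk+nC[k+1]≡[n+1]C[k+1]; nC1≡n)
open import Data.Nat.DivMod using (_%_)
open import Data.Bool using (true; false; if_then_else_; T) renaming (_≟_ to _≟ᵇ_)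
open import Data.List using (List; []; _∷_; map; downFrom; length)
open import Data.List.Properties using (map-cong-local)
open import Data.List.Relation.Unary.All as All using (All)
open import Data.List.Relation.Unary.All.Properties using (¬All⇒Any¬)
open import Data.List.Relation.Unary.Any using (Any; here; there)
open import Data.List.Membership.Propositional using (_∈_; find; lose)
open import Data.List.Membership.Propositional.Properties
  using (∈-map⁺; ∈-map⁻; ∈-concatMap⁺; ∈-concatMap⁻; ∈-downFrom⁺; ∈-downFrom⁻)
open import Data.Vec using (Vec; []; _∷_; lookup)
open import Data.Vec.Base using () renaming (here to hereᵥ; there to thereᵥ)
import Data.Vec as Vec
open import Data.Vec.Properties using (lookup-map; ≡-dec)
open import Data.Fin using (Fin; zero; suc)
open import Data.Fin.Properties using (any?)
open import Data.Fin.Subset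
  using (Subset; inside; outside; Nonempty; ∁; _∪_; _⊆_)
  renaming (_∈_ to _∈ₛ_; _∉_ to _∉ₛ_)
open import Data.Fin.Subset.Properties
  using (_∈?_; drop-there; ⊆-antisym; x∈p⇒x∉∁p; x∈∁p⇒x∉p; x∉p⇒x∈∁p; x∈p∪q⁺; x∈p∪q⁻)
open import Data.Product using (_×_; _,_; ∃)
open import Data.Sum using (_⊎_; inj₁; inj₂; [_,_]′; swap)
open import Data.Empty using (⊥-elim)
open import Function using (_∘_)
open import Relation.Nullary using (¬_; Dec; yes; no)
open import Relation.Nullary.Decidable using (_×-dec_; _⊎-dec_; ¬?; decidable-stable)
open import Relation.Binary.PropositionalEquality

data Move : {n : ℕ} → Subset n → Position n → Position n → Set where
  done : Move [] [] []
  take : ∀ {n E x x′ a b} → b < a → Move {n} E x x′ → Move (inside ∷ E) (a ∷ x) (b ∷ x′)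
  keep : ∀ {n E x x′ a} → Move {n} E x x′ → Move (outside ∷ E) (a ∷ x) (a ∷ x′)

edgeMoves-sound : ∀ {n} (E : Subset n) (x : Position n) {x′} → x′ ∈ edgeMoves E x → Move E x x′
edgeMoves-sound [] [] (here refl) = done
edgeMoves-sound (inside ∷ E) (a ∷ x) p
  with b , b∈ , q ← find (∈-concatMap⁻ (λ b → map (b ∷_) (edgeMoves E x)) {xs = downFrom a} p)
  with x′ , x′∈ , refl ← ∈-map⁻ (b ∷_) q
  = take (∈-downFrom⁻ b∈) (edgeMoves-sound E x x′∈)
edgeMoves-sound (outside ∷ E) (a ∷ x) p
  with x′ , x′∈ , refl ← ∈-map⁻ (a ∷_) p
  = keep (edgeMoves-sound E x x′∈)

edgeMoves-complete : ∀ {n} {E : Subset n} {x x′} → Move E x x′ → x′ ∈ edgeMoves E x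
edgeMoves-complete done = here refl
edgeMoves-complete {E = inside ∷ E} {x = a ∷ x} (take {b = b} b<a m) =
  ∈-concatMap⁺ (λ b → map (b ∷_) (edgeMoves E x))
    (lose (∈-downFrom⁺ b<a) (∈-map⁺ (b ∷_) (edgeMoves-complete m)))
edgeMoves-complete (keep m) = ∈-map⁺ _ (edgeMoves-complete m)

move-inside : ∀ {n} {E : Subset n} {x x′} → Move E x x′ → ∀ {i} → i ∈ₛ E → lookup x′ i < lookup x i
move-inside (take b<a _) hereᵥ = b<a
move-inside (take _ m) (thereᵥ i∈E) = move-inside m i∈E
move-inside (keep m) (thereᵥ i∈E) = move-inside m i∈E

move-outside : ∀ {n} {E : Subset n} {x x′} → Move E x x′ → ∀ {i} → i ∉ₛ E → lookup x′ i ≡ lookup x i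
move-outside (take _ _) {zero} i∉E = ⊥-elim (i∉E hereᵥ)
move-outside (take _ m) {suc i} i∉E = move-outside m (i∉E ∘ thereᵥ)
move-outside (keep _) {zero} _ = refl
move-outside (keep m) {suc i} i∉E = move-outside m (i∉E ∘ thereᵥ)

move-≤ : ∀ {n} {E : Subset n} {x x′} → Move E x x′ → ∀ i → lookup x′ i ≤ lookup x i
move-≤ {E = E} m i with i ∈? E
... | yes i∈E = <⇒≤ (move-inside m i∈E)
... | no i∉E = ≤-reflexive (move-outside m i∉E)

move-total≤ : ∀ {n} {E : Subset n} {x x′} → Move E x x′ → total x′ ≤ total x
move-total≤ done = z≤n
move-total≤ (take b<a m) = +-mono-≤ (<⇒≤ b<a) (move-total≤ m)
move-total≤ (keep {a = a} m) = +-monoʳ-≤ a (move-total≤ m)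

move-total< : ∀ {n} {E : Subset n} {x x′} → Move E x x′ → Nonempty E → total x′ < total x
move-total< (take b<a m) (zero , _) = +-mono-<-≤ b<a (move-total≤ m)
move-total< (take b<a m) (suc i , thereᵥ i∈E) = +-mono-≤-< (<⇒≤ b<a) (move-total< m (i , i∈E))
move-total< (keep {a = a} m) (suc i , thereᵥ i∈E) = +-monoʳ-< a (move-total< m (i , i∈E))

Playable : ∀ {n} → Position n → Subset n → Set
Playable x E = ∀ {i} → i ∈ₛ E → 0 < lookup x i

playable⇒move : ∀ {n} (E : Subset n) (x : Position n) → Playable x E → ∃ (Move E x)
playable⇒move [] [] _ = [] , done
playable⇒move (inside ∷ E) (a ∷ x) pl with x′ , m ← playable⇒move E x (pl ∘ thereᵥ) =
  0 ∷ x′ , take (pl hereᵥ) m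
playable⇒move (outside ∷ E) (a ∷ x) pl with x′ , m ← playable⇒move E x (pl ∘ thereᵥ) =
  a ∷ x′ , keep m

Disjoint : ∀ {n} → Subset n → Subset n → Set
Disjoint G A = ∀ {i} → i ∈ₛ G → i ∉ₛ A

move-keeps-playable : ∀ {n} {G A : Subset n} {x x′} → Move G x x′ → Disjoint G A →
                      Playable x A → Playable x′ A
move-keeps-playable m G∩A=∅ pl i∈A =
  subst (0 <_) (sym (move-outside m (λ i∈G → G∩A=∅ i∈G i∈A))) (pl i∈A)

elemℕ-sound : ∀ k l → T (elemℕ k l) → k ∈ l
elemℕ-sound k (m ∷ l) t with m ≡ᵇ k in eq
... | true = here (sym (≡ᵇ⇒≡ m k (subst T (sym eq) t)))
... | false = there (elemℕ-sound k l t)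

mexAux-≤ : ∀ fuel j k l → j ≤ k → ¬ k ∈ l → mexAux fuel j l ≤ k
mexAux-≤ zero j k l j≤k _ = j≤k
mexAux-≤ (suc fuel) j k l j≤k k∉l with elemℕ j l in eq
... | false = j≤k
... | true with m≤n⇒m<n∨m≡n j≤k
...   | inj₁ j<k = mexAux-≤ fuel (suc j) k l j<k k∉l
...   | inj₂ refl = ⊥-elim (k∉l (elemℕ-sound j l (subst T (sym eq) _)))

mex-≤ : ∀ l k → ¬ k ∈ l → mex l ≤ k
mex-≤ l k = mexAux-≤ (length l) 0 k l z≤n

heightStep : List ℕ → ℕ
heightStep [] = 0
heightStep hs@(_ ∷ _) = suc (maxList hs)

maxList-≥ : ∀ {h} hs → h ∈ hs → h ≤ maxList hs
maxList-≥ (h ∷ hs) (here refl) = m≤m⊔n h (maxList hs)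
maxList-≥ (h ∷ hs) (there p) = ≤-trans (maxList-≥ hs p) (m≤n⊔m h (maxList hs))

maxList-≤ : ∀ hs k → (∀ {h} → h ∈ hs → h ≤ k) → maxList hs ≤ k
maxList-≤ [] k _ = z≤n
maxList-≤ (h ∷ hs) k bound = ⊔-lub (bound (here refl)) (maxList-≤ hs k (bound ∘ there))

heightStep-> : ∀ {h} hs → h ∈ hs → h < heightStep hs
heightStep-> hs@(_ ∷ _) p = s≤s (maxList-≥ hs p)

heightStep-≤ : ∀ hs k → (∀ {h} → h ∈ hs → h ≤ k) → heightStep hs ≤ suc k
heightStep-≤ [] k _ = z≤n
heightStep-≤ hs@(_ ∷ _) k bound = s≤s (maxList-≤ hs k bound)

module Game {n : ℕ} (ℋ : List (Subset n)) (edges-nonempty : All Nonempty ℋ) where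

  option⇒move : ∀ {x y} → y ∈ moves ℋ x → ∃ λ E → E ∈ ℋ × Move E x y
  option⇒move {x} p with E , E∈ℋ , q ← find (∈-concatMap⁻ (λ E → edgeMoves E x) {xs = ℋ} p) =
    E , E∈ℋ , edgeMoves-sound E x q

  move⇒option : ∀ {x y E} → E ∈ ℋ → Move E x y → y ∈ moves ℋ x
  move⇒option {x} E∈ℋ m = ∈-concatMap⁺ (λ E → edgeMoves E x) (lose E∈ℋ (edgeMoves-complete m))

  option-total< : ∀ {x y} → y ∈ moves ℋ x → total y < total x
  option-total< p with E , E∈ℋ , m ← option⇒move p = move-total< m (All.lookup edges-nonempty E∈ℋ)

  -- A fuelled recursion over the options no longer depends on the fuel once
  -- the fuel exceeds the number of stones; this yields the recursive equation.
  module Fuelled (F : ℕ → Position n → ℕ) (step : List ℕ → ℕ)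
                 (F-suc : ∀ fuel x → F (suc fuel) x ≡ step (map (F fuel) (moves ℋ x))) where

    fuel-irrelevant : ∀ f g x → total x < f → total x < g → F f x ≡ F g x
    fuel-irrelevant (suc f) (suc g) x (s≤s x<f) (s≤s x<g) = begin
      F (suc f) x                      ≡⟨ F-suc f x ⟩
      step (map (F f) (moves ℋ x))     ≡⟨ cong step (map-cong-local (All.tabulate same)) ⟩
      step (map (F g) (moves ℋ x))     ≡⟨ F-suc g x ⟨
      F (suc g) x                      ∎
      where
      open ≡-Reasoning
      same : ∀ {y} → y ∈ moves ℋ x → F f y ≡ F g y
      same p = fuel-irrelevant f g _ (<-≤-trans (option-total< p) x<f) (<-≤-trans (option-total< p) x<g)

    unfold : ∀ x → F (suc (total x)) x ≡ step (map (λ y → F (suc (total y)) y) (moves ℋ x))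
    unfold x = trans (F-suc (total x) x) (cong step (map-cong-local (All.tabulate λ p →
      fuel-irrelevant (total x) _ _ (option-total< p) ≤-refl)))

  SG-unfold : ∀ x → SG ℋ x ≡ mex (map (SG ℋ) (moves ℋ x))
  SG-unfold = Fuelled.unfold (sgFuel ℋ) mex (λ _ _ → refl)

  heightFuel-suc : ∀ fuel x →
                   heightFuel ℋ (suc fuel) x ≡ heightStep (map (heightFuel ℋ fuel) (moves ℋ x))
  heightFuel-suc fuel x with moves ℋ x
  ... | [] = refl
  ... | _ ∷ _ = refl

  height-unfold : ∀ x → height ℋ x ≡ heightStep (map (height ℋ) (moves ℋ x))
  height-unfold = Fuelled.unfold (heightFuel ℋ) heightStep heightFuel-suc

  height-option : ∀ {x y} → y ∈ moves ℋ x → suc (height ℋ y) ≤ height ℋ x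
  height-option {x} p rewrite height-unfold x = heightStep-> _ (∈-map⁺ (height ℋ) p)

  height-≤ : ∀ x k → (∀ {y} → y ∈ moves ℋ x → height ℋ y ≤ k) → height ℋ x ≤ suc k
  height-≤ x k bound rewrite height-unfold x = heightStep-≤ _ k λ h∈ →
    let y , y∈ , h≡ = ∈-map⁻ (height ℋ) h∈ in subst (_≤ k) (sym h≡) (bound y∈)

  no-option⇒height≡0 : ∀ x → (∀ {y} → ¬ y ∈ moves ℋ x) → height ℋ x ≡ 0
  no-option⇒height≡0 x none rewrite height-unfold x with moves ℋ x
  ... | [] = refl
  ... | _ ∷ _ = ⊥-elim (none (here refl))

  SG-≤ : ∀ x k → (∀ {y} → y ∈ moves ℋ x → SG ℋ y ≢ k) → SG ℋ x ≤ k
  SG-≤ x k avoid rewrite SG-unfold x = mex-≤ _ k λ k∈ →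
    let y , y∈ , k≡ = ∈-map⁻ (SG ℋ) k∈ in avoid y∈ (sym k≡)

  playable⇒height≥1 : ∀ {x E} → E ∈ ℋ → Playable x E → 1 ≤ height ℋ x
  playable⇒height≥1 {x} {E} E∈ℋ pl =
    let _ , m = playable⇒move E x pl in ≤-trans (s≤s z≤n) (height-option (move⇒option E∈ℋ m))

  Blocked : Position n → Set
  Blocked x = ∀ {E} → E ∈ ℋ → ∃ λ i → i ∈ₛ E × lookup x i ≡ 0

  blocked⇒height≡0 : ∀ x → Blocked x → height ℋ x ≡ 0
  blocked⇒height≡0 x blocked = no-option⇒height≡0 x λ {y} p →
    let E , E∈ℋ , m = option⇒move p
        i , i∈E , xi≡0 = blocked E∈ℋ
    in n≮0 (subst (lookup y i <_) xi≡0 (move-inside m i∈E))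

min-≤ : ∀ {n} (x : Position n) i → minPos x ≤ lookup x i
min-≤ (a ∷ []) zero = ≤-refl
min-≤ (a ∷ b ∷ v) zero = m⊓n≤m a (minPos (b ∷ v))
min-≤ (a ∷ b ∷ v) (suc i) = ≤-trans (m⊓n≤n a (minPos (b ∷ v))) (min-≤ (b ∷ v) i)

min-≥ : ∀ {n} (x : Position n) → Fin n → ∀ c → (∀ i → c ≤ lookup x i) → c ≤ minPos x
min-≥ (a ∷ []) _ c low = low zero
min-≥ (a ∷ b ∷ v) _ c low = ⊓-glb (low zero) (min-≥ (b ∷ v) zero c (low ∘ suc))

min-zero : ∀ {n} (x : Position n) i → lookup x i ≡ 0 → minPos x ≡ 0
min-zero x i xi≡0 = n≤0⇒n≡0 (subst (minPos x ≤_) xi≡0 (min-≤ x i))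

-- f as a function of m(x), h(x − m(x)e) and h(x): fH ℋ x is by definition
-- fFormula (minPos x) (hRed ℋ x) (height ℋ x).
fFormula : ℕ → ℕ → ℕ → ℕ
fFormula m r h = if m ≤ᵇ (suc r C 2) then h else (suc r C 2) + ((m ∸ (suc r C 2) ∸ 1) % suc r)

fFormula-low : ∀ m r h → m ≤ suc r C 2 → fFormula m r h ≡ h
fFormula-low m r h m≤ with m ≤ᵇ suc r C 2 | ≤⇒≤ᵇ m≤
... | true | _ = refl

r≤C[1+r,2] : ∀ r → r ≤ suc r C 2
r≤C[1+r,2] r = subst (r ≤_) (begin
  r + r C 2      ≡⟨ cong (_+ r C 2) (nC1≡n r) ⟨
  r C 1 + r C 2  ≡⟨ nCk+nC[k+1]≡[n+1]C[k+1] r 1 ⟩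
  suc r C 2      ∎) (m≤m+n r (r C 2))
  where open ≡-Reasoning

f-empty-pile : ∀ {n} (ℋ : List (Subset n)) x i → lookup x i ≡ 0 → fH ℋ x ≡ height ℋ x
f-empty-pile ℋ x i xi≡0 = cong (λ m → fFormula m (hRed ℋ x) (height ℋ x)) (min-zero x i xi≡0)

f-height : ∀ {n} (ℋ : List (Subset n)) x → minPos x ≤ 1 → 1 ≤ hRed ℋ x → fH ℋ x ≡ height ℋ x
f-height ℋ x m≤1 1≤r = fFormula-low (minPos x) (hRed ℋ x) (height ℋ x)
  (≤-trans m≤1 (≤-trans 1≤r (r≤C[1+r,2] (hRed ℋ x))))

f-zero : ∀ {n} (ℋ : List (Subset n)) x → minPos x ≡ 1 → hRed ℋ x ≡ 0 → fH ℋ x ≡ 0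
f-zero ℋ x m≡1 r≡0 = cong₂ (λ m r → fFormula m r (height ℋ x)) m≡1 r≡0

twoValued : ∀ {n} → Subset n → ℕ → ℕ → Position n
twoValued [] a b = []
twoValued (u ∷ A) a b = (if u then a else b) ∷ twoValued A a b

twoValued-inside : ∀ {n} {A : Subset n} {a b i} → i ∈ₛ A → lookup (twoValued A a b) i ≡ a
twoValued-inside hereᵥ = refl
twoValued-inside (thereᵥ i∈A) = twoValued-inside i∈A

twoValued-outside : ∀ {n} {A : Subset n} {a b i} → i ∉ₛ A → lookup (twoValued A a b) i ≡ b
twoValued-outside {A = inside ∷ A} {i = zero} i∉A = ⊥-elim (i∉A hereᵥ)
twoValued-outside {A = outside ∷ A} {i = zero} _ = refl
twoValued-outside {A = _ ∷ A} {i = suc i} i∉A = twoValued-outside (i∉A ∘ thereᵥ)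

twoValued-unique : ∀ {n} {A : Subset n} {a b} {y : Position n} → (∀ {i} → i ∈ₛ A → lookup y i ≡ a) →
                   (∀ {i} → i ∉ₛ A → lookup y i ≡ b) → y ≡ twoValued A a b
twoValued-unique {A = []} {y = []} _ _ = refl
twoValued-unique {A = inside ∷ A} {y = c ∷ y} on off =
  cong₂ _∷_ (on hereᵥ) (twoValued-unique (on ∘ thereᵥ) (λ i∉A → off (i∉A ∘ drop-there)))
twoValued-unique {A = outside ∷ A} {y = c ∷ y} on off =
  cong₂ _∷_ (off {zero} λ ()) (twoValued-unique (on ∘ thereᵥ) (λ i∉A → off (i∉A ∘ drop-there)))

twoValued-map : ∀ {n} (A : Subset n) a b (g : ℕ → ℕ) →
                Vec.map g (twoValued A a b) ≡ twoValued A (g a) (g b)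
twoValued-map [] a b g = refl
twoValued-map (inside ∷ A) a b g = cong (g a ∷_) (twoValued-map A a b g)
twoValued-map (outside ∷ A) a b g = cong (g b ∷_) (twoValued-map A a b g)

twoValued-min : ∀ {n} {A : Subset n} {a b} → Nonempty A → a ≤ b → minPos (twoValued A a b) ≡ a
twoValued-min {A = A} {a} {b} (s , s∈A) a≤b =
  ≤-antisym (subst (minPos x ≤_) (twoValued-inside s∈A) (min-≤ x s)) (min-≥ x s a low)
  where
  x : Position _
  x = twoValued A a b
  low : ∀ i → a ≤ lookup x i
  low i with i ∈? A
  ... | yes i∈A = ≤-reflexive (sym (twoValued-inside i∈A))
  ... | no i∉A = subst (a ≤_) (sym (twoValued-outside i∉A)) a≤b

twoValued-move-inside : ∀ {n} (A : Subset n) a b → Move A (twoValued A (suc a) b) (twoValued A a b)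
twoValued-move-inside [] a b = done
twoValued-move-inside (inside ∷ A) a b = take ≤-refl (twoValued-move-inside A a b)
twoValued-move-inside (outside ∷ A) a b = keep (twoValued-move-inside A a b)

twoValued-move-outside : ∀ {n} (A : Subset n) a b → Move (∁ A) (twoValued A a (suc b)) (twoValued A a b)
twoValued-move-outside [] a b = done
twoValued-move-outside (inside ∷ A) a b = keep (twoValued-move-outside A a b)
twoValued-move-outside (outside ∷ A) a b = take ≤-refl (twoValued-move-outside A a b)

record FreeVertex {n : ℕ} (ℋ : List (Subset n)) : Set where
  field
    E F       : Subset n
    E∈ℋ       : E ∈ ℋ
    F∈ℋ       : F ∈ ℋ
    k         : Fin n
    k∉E       : k ∉ₛ E
    k∉F       : k ∉ₛ F
    separated : All (λ G → Disjoint G F ⊎ Disjoint G E) ℋ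

-- At x = 1 on E ∪ F and 0 elsewhere, pile k is empty in x and in all its
-- options, so f = h there.  Every option still has E or F playable, hence
-- height ≥ 1 and 𝒢 ≠ 0; thus 𝒢(x) = 0 while f(x) = h(x) ≥ 1.
freeVertex⇒¬JM : ∀ {n} {ℋ : List (Subset n)} → All Nonempty ℋ → FreeVertex ℋ → ¬ IsJM ℋ
freeVertex⇒¬JM {ℋ = ℋ} nonempty ob jm = <⇒≱ (subst (1 ≤_) (sym 𝒢x≡hx) 1≤hx) 𝒢x≤0
  where
  open FreeVertex ob
  open Game ℋ nonempty

  x : Position _
  x = twoValued (E ∪ F) 1 0

  xk≡0 : lookup x k ≡ 0
  xk≡0 = twoValued-outside ([ k∉E , k∉F ]′ ∘ x∈p∪q⁻ E F)

  playable : ∀ {A} → A ⊆ E ∪ F → Playable x A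
  playable A⊆E∪F i∈A = subst (0 <_) (sym (twoValued-inside (A⊆E∪F i∈A))) (s≤s z≤n)

  1≤hx : 1 ≤ height ℋ x
  1≤hx = playable⇒height≥1 E∈ℋ (playable (x∈p∪q⁺ ∘ inj₁))

  𝒢x≡hx : SG ℋ x ≡ height ℋ x
  𝒢x≡hx = trans (jm x) (f-empty-pile ℋ x k xk≡0)

  option-1≤f : ∀ {y} → y ∈ moves ℋ x → 1 ≤ fH ℋ y
  option-1≤f {y} p with G , G∈ℋ , m ← option⇒move p =
    subst (1 ≤_) (sym (f-empty-pile ℋ y k yk≡0)) (still-playable (All.lookup separated G∈ℋ))
    where
    yk≡0 : lookup y k ≡ 0
    yk≡0 = n≤0⇒n≡0 (subst (lookup y k ≤_) xk≡0 (move-≤ m k))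
    still-playable : Disjoint G F ⊎ Disjoint G E → 1 ≤ height ℋ y
    still-playable (inj₁ G∩F=∅) =
      playable⇒height≥1 F∈ℋ (move-keeps-playable m G∩F=∅ (playable (x∈p∪q⁺ ∘ inj₂)))
    still-playable (inj₂ G∩E=∅) =
      playable⇒height≥1 E∈ℋ (move-keeps-playable m G∩E=∅ (playable (x∈p∪q⁺ ∘ inj₁)))

  𝒢x≤0 : SG ℋ x ≤ 0
  𝒢x≤0 = SG-≤ x 0 λ {y} p 𝒢y≡0 → <⇒≱ (option-1≤f p) (≤-reflexive (trans (sym (jm y)) 𝒢y≡0))

record TwoBlocks {n : ℕ} (ℋ : List (Subset n)) : Set where
  field
    S    : Subset n
    S∈ℋ  : S ∈ ℋ
    ∁S∈ℋ : ∁ S ∈ ℋ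
    only : All (λ G → G ≡ S ⊎ G ≡ ∁ S) ℋ
    s    : Fin n
    s∈S  : s ∈ₛ S

below3 : ∀ {c} → c < 3 → c ≢ 0 → c ≢ 1 → c ≡ 2
below3 {0} _ c≢0 _ = ⊥-elim (c≢0 refl)
below3 {1} _ _ c≢1 = ⊥-elim (c≢1 refl)
below3 {2} _ _ _ = refl
below3 {suc (suc (suc _))} (s≤s (s≤s (s≤s ())))

-- At x = pos 1 3 we have f(x) = h(x) ≥ 4, but no option y has
-- f(y) = 2: after an S-move y = pos 0 3 and f(y) = h(y) ≥ 3; after a ∁S-move y
-- is 1 on S and below 3 off S, and f(y) is h(y) ≤ 1, 0, or h(y) ≥ 3 according
-- to the smallest pile off S.
module TwoBlocksGame {n : ℕ} {ℋ : List (Subset n)} (nonempty : All Nonempty ℋ) (ob : TwoBlocks ℋ) where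
  open TwoBlocks ob
  open Game ℋ nonempty

  pos : ℕ → ℕ → Position n
  pos = twoValued S

  -- Alternating single-stone moves by S and ∁S give h(pos a b) ≥ a + b.
  height-pos : ∀ a b → a + b ≤ height ℋ (pos a b)
  height-pos zero zero = z≤n
  height-pos (suc a) zero =
    ≤-trans (s≤s (height-pos a zero)) (height-option (move⇒option S∈ℋ (twoValued-move-inside S a zero)))
  height-pos a (suc b) = subst (_≤ height ℋ (pos a (suc b))) (sym (+-suc a b))
    (≤-trans (s≤s (height-pos a b)) (height-option (move⇒option ∁S∈ℋ (twoValued-move-outside S a b))))

  min-pos : ∀ {a b} → a ≤ b → minPos (pos a b) ≡ a
  min-pos = twoValued-min (s , s∈S)

  hRed-pos : ∀ {a b} → a ≤ b → hRed ℋ (pos a b) ≡ height ℋ (pos 0 (b ∸ a))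
  hRed-pos {a} {b} a≤b = cong (height ℋ) (begin
    Vec.map (_∸ minPos (pos a b)) (pos a b)  ≡⟨ cong (λ m → Vec.map (_∸ m) (pos a b)) (min-pos a≤b) ⟩
    Vec.map (_∸ a) (pos a b)                 ≡⟨ twoValued-map S a b (_∸ a) ⟩
    pos (a ∸ a) (b ∸ a)                      ≡⟨ cong (λ c → pos c (b ∸ a)) (n∸n≡0 a) ⟩
    pos 0 (b ∸ a)                            ∎)
    where open ≡-Reasoning

  f-pos : ∀ b → 2 ≤ b → fH ℋ (pos 1 b) ≡ height ℋ (pos 1 b)
  f-pos b@(suc b′) (s≤s 1≤b′) = f-height ℋ (pos 1 b) (≤-reflexive (min-pos (s≤s z≤n)))
    (subst (1 ≤_) (sym (hRed-pos (s≤s z≤n))) (≤-trans 1≤b′ (height-pos 0 b′)))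

  blocked : ∀ z {j} → lookup z s ≡ 0 → j ∉ₛ S → lookup z j ≡ 0 → Blocked z
  blocked z {j} zs≡0 j∉S zj≡0 G∈ℋ with All.lookup only G∈ℋ
  ... | inj₁ refl = s , s∈S , zs≡0
  ... | inj₂ refl = j , x∉p⇒x∈∁p j∉S , zj≡0

  x : Position n
  x = pos 1 3

  f-after-S : ∀ {y} → Move S x y → 3 ≤ fH ℋ y
  f-after-S {y} m = subst (3 ≤_) (sym (f-empty-pile ℋ y s ys≡0))
    (subst (λ z → 3 ≤ height ℋ z) (sym y≡pos03) (height-pos 0 3))
    where
    y≡pos03 : y ≡ pos 0 3
    y≡pos03 = twoValued-unique
      (λ i∈S → n<1⇒n≡0 (subst (lookup y _ <_) (twoValued-inside i∈S) (move-inside m i∈S)))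
      (λ i∉S → trans (move-outside m i∉S) (twoValued-outside i∉S))
    ys≡0 : lookup y s ≡ 0
    ys≡0 = trans (cong (λ z → lookup z s) y≡pos03) (twoValued-inside s∈S)

  module AfterComplement {y : Position n} (m : Move (∁ S) x y) where

    on-S : ∀ {i} → i ∈ₛ S → lookup y i ≡ 1
    on-S i∈S = trans (move-outside m (x∈p⇒x∉∁p i∈S)) (twoValued-inside i∈S)

    off-S : ∀ {j} → j ∉ₛ S → lookup y j < 3
    off-S j∉S = subst (lookup y _ <_) (twoValued-outside j∉S) (move-inside m (x∉p⇒x∈∁p j∉S))

    PileOffS : ℕ → Set
    PileOffS c = ∃ λ j → j ∉ₛ S × lookup y j ≡ c

    pileOffS? : ∀ c → Dec (PileOffS c)
    pileOffS? c = any? (λ j → ¬? (j ∈? S) ×-dec (lookup y j ≟ c))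

    -- An empty pile j off S: any S-move then empties s, and ∁S-moves are
    -- impossible, so h(y) ≤ 1 = f(y).
    empty-pile : PileOffS 0 → fH ℋ y ≤ 1
    empty-pile (j , j∉S , yj≡0) = subst (_≤ 1) (sym (f-empty-pile ℋ y j yj≡0))
      (height-≤ y 0 λ {z} p → ≤-reflexive (blocked⇒height≡0 z (options-blocked p)))
      where
      options-blocked : ∀ {z} → z ∈ moves ℋ y → Blocked z
      options-blocked {z} p with G , G∈ℋ , m′ ← option⇒move p with All.lookup only G∈ℋ
      ... | inj₁ refl = blocked z (n<1⇒n≡0 (subst (lookup z s <_) (on-S s∈S) (move-inside m′ s∈S)))
                                j∉S (n≤0⇒n≡0 (subst (lookup z j ≤_) yj≡0 (move-≤ m′ j)))
      ... | inj₂ refl = ⊥-elim (n≮0 (subst (lookup z j <_) yj≡0 (move-inside m′ (x∉p⇒x∈∁p j∉S))))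

    -- No empty pile but a pile j off S with one stone: m(y) = 1 and y − e is
    -- blocked, so f(y) = 0.
    pile-one : ¬ PileOffS 0 → PileOffS 1 → fH ℋ y ≡ 0
    pile-one no-empty (j , j∉S , yj≡1) = f-zero ℋ y min≡1
      (blocked⇒height≡0 y−e (blocked y−e (reduced-empty (on-S s∈S)) j∉S (reduced-empty yj≡1)))
      where
      positive : ∀ i → 1 ≤ lookup y i
      positive i with i ∈? S
      ... | yes i∈S = ≤-reflexive (sym (on-S i∈S))
      ... | no i∉S = n≢0⇒n>0 (λ yi≡0 → no-empty (i , i∉S , yi≡0))
      min≡1 : minPos y ≡ 1
      min≡1 = ≤-antisym (subst (minPos y ≤_) (on-S s∈S) (min-≤ y s)) (min-≥ y s 1 positive)
      y−e : Position n
      y−e = Vec.map (_∸ minPos y) y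
      reduced-empty : ∀ {i} → lookup y i ≡ 1 → lookup y−e i ≡ 0
      reduced-empty {i} yi≡1 = trans (lookup-map i (_∸ minPos y) y) (cong₂ _∸_ yi≡1 min≡1)

    -- Otherwise every pile off S holds two stones: y = pos 1 2 and f(y) = h(y) ≥ 3.
    piles-two : ¬ PileOffS 0 → ¬ PileOffS 1 → 3 ≤ fH ℋ y
    piles-two no-empty no-one = subst (λ z → 3 ≤ fH ℋ z) (sym y≡pos12)
      (subst (3 ≤_) (sym (f-pos 2 ≤-refl)) (height-pos 1 2))
      where
      y≡pos12 : y ≡ pos 1 2
      y≡pos12 = twoValued-unique on-S λ {i} i∉S →
        below3 (off-S i∉S) (λ yi≡0 → no-empty (i , i∉S , yi≡0)) (λ yi≡1 → no-one (i , i∉S , yi≡1))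

    f≢2 : fH ℋ y ≢ 2
    f≢2 f≡2 with pileOffS? 0 | pileOffS? 1
    ... | yes empty | _ = <⇒≱ (s≤s (s≤s z≤n)) (subst (_≤ 1) f≡2 (empty-pile empty))
    ... | no no-empty | yes one = 0≢1+n (trans (sym (pile-one no-empty one)) f≡2)
    ... | no no-empty | no no-one = <⇒≱ ≤-refl (subst (3 ≤_) f≡2 (piles-two no-empty no-one))

  option-f≢2 : ∀ {y} → y ∈ moves ℋ x → fH ℋ y ≢ 2
  option-f≢2 p with G , G∈ℋ , m ← option⇒move p with All.lookup only G∈ℋ
  ... | inj₁ refl = λ f≡2 → <⇒≱ ≤-refl (subst (3 ≤_) f≡2 (f-after-S m))
  ... | inj₂ refl = AfterComplement.f≢2 m

  ¬JM : ¬ IsJM ℋ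
  ¬JM jm = <⇒≱ (s≤s (s≤s (s≤s z≤n))) (≤-trans 4≤𝒢x 𝒢x≤2)
    where
    4≤𝒢x : 4 ≤ SG ℋ x
    4≤𝒢x = subst (4 ≤_) (sym (trans (jm x) (f-pos 3 (s≤s (s≤s z≤n))))) (height-pos 1 3)
    𝒢x≤2 : SG ℋ x ≤ 2
    𝒢x≤2 = SG-≤ x 2 λ {y} p 𝒢y≡2 → option-f≢2 p (trans (sym (jm y)) 𝒢y≡2)

missing-vertex : ∀ {n} {G A : Subset n} → G ⊆ A → G ≢ A → ∃ λ k → k ∈ₛ A × k ∉ₛ G
missing-vertex {G = G} {A} G⊆A G≢A with any? (λ k → (k ∈? A) ×-dec ¬? (k ∈? G))
... | yes found = found
... | no none = ⊥-elim (G≢A (⊆-antisym G⊆A A⊆G))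
  where
  A⊆G : A ⊆ G
  A⊆G {k} k∈A = decidable-stable (k ∈? G) λ k∉G → none (k , k∈A , k∉G)

module _ {n : ℕ} {ℋ : List (Subset n)} {A B : Subset n} (A∩B=∅ : Disjoint A B) where

  edge-within : All (λ G → G ⊆ A ⊎ G ⊆ B) ℋ → ∀ {i} → Any (i ∈ₛ_) ℋ → i ∈ₛ A →
                ∃ λ G → G ∈ ℋ × G ⊆ A
  edge-within within covers-i i∈A with G , G∈ℋ , i∈G ← find covers-i with All.lookup within G∈ℋ
  ... | inj₁ G⊆A = G , G∈ℋ , G⊆A
  ... | inj₂ G⊆B = ⊥-elim (A∩B=∅ i∈A (G⊆B i∈G))

  block-present : All (λ G → G ≡ A ⊎ G ≡ B) ℋ → ∀ {i} → Any (i ∈ₛ_) ℋ → i ∈ₛ A → A ∈ ℋ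
  block-present only covers-i i∈A with G , G∈ℋ , i∈G ← find covers-i with All.lookup only G∈ℋ
  ... | inj₁ refl = G∈ℋ
  ... | inj₂ refl = ⊥-elim (A∩B=∅ i∈A i∈G)

  proper-edge⇒freeVertex : All (λ H → H ⊆ A ⊎ H ⊆ B) ℋ → ∀ {G F k} → G ∈ ℋ → G ⊆ A →
                           k ∈ₛ A → k ∉ₛ G → F ∈ ℋ → F ⊆ B → FreeVertex ℋ
  proper-edge⇒freeVertex within {G} {F} {k} G∈ℋ G⊆A k∈A k∉G F∈ℋ F⊆B = record
    { E = G ; F = F ; E∈ℋ = G∈ℋ ; F∈ℋ = F∈ℋ ; k = k ; k∉E = k∉G
    ; k∉F = λ k∈F → A∩B=∅ k∈A (F⊆B k∈F)
    ; separated = All.map side within }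
    where
    side : ∀ {H} → H ⊆ A ⊎ H ⊆ B → Disjoint H F ⊎ Disjoint H G
    side (inj₁ H⊆A) = inj₁ λ i∈H i∈F → A∩B=∅ (H⊆A i∈H) (F⊆B i∈F)
    side (inj₂ H⊆B) = inj₂ λ i∈H i∈G → A∩B=∅ (G⊆A i∈G) (H⊆B i∈H)

is-side? : ∀ {n} (S G : Subset n) → Dec (G ≡ S ⊎ G ≡ ∁ S)
is-side? S G = ≡-dec _≟ᵇ_ G S ⊎-dec ≡-dec _≟ᵇ_ G (∁ S)

disconnected⇒obstruction : ∀ {n} {ℋ : List (Subset n)} → IsHypergraph ℋ → NotConnected ℋ →
                           FreeVertex ℋ ⊎ TwoBlocks ℋ
disconnected⇒obstruction {ℋ = ℋ} (_ , _ , covers) (S , (s , s∈S) , (t , t∈∁S) , within)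
  with All.all? (is-side? S) ℋ
... | yes only = inj₂ (record
  { S = S ; only = only ; s = s ; s∈S = s∈S
  ; S∈ℋ = block-present x∈p⇒x∉∁p only (covers s) s∈S
  ; ∁S∈ℋ = block-present x∈∁p⇒x∉p (All.map swap only) (covers t) t∈∁S })
... | no not-only
  with G , G∈ℋ , not-side ← find (¬All⇒Any¬ (is-side? S) ℋ not-only)
  with All.lookup within G∈ℋ
... | inj₁ G⊆S =
  let k , k∈S , k∉G = missing-vertex G⊆S (not-side ∘ inj₁)
      F , F∈ℋ , F⊆∁S = edge-within x∈∁p⇒x∉p (All.map swap within) (covers t) t∈∁S
  in inj₁ (proper-edge⇒freeVertex x∈p⇒x∉∁p within G∈ℋ G⊆S k∈S k∉G F∈ℋ F⊆∁S)
... | inj₂ G⊆∁S =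
  let k , k∈∁S , k∉G = missing-vertex G⊆∁S (not-side ∘ inj₂)
      F , F∈ℋ , F⊆S = edge-within x∈p⇒x∉∁p within (covers s) s∈S
  in inj₁ (proper-edge⇒freeVertex x∈∁p⇒x∉p (All.map swap within) G∈ℋ G⊆∁S k∈∁S k∉G F∈ℋ F⊆S)

lemma3p1 : (n : ℕ) (ℋ : List (Subset n)) → IsHypergraph ℋ → IsJM ℋ → Connected ℋ
lemma3p1 n ℋ hypergraph@(_ , nonempty , _) jm disconnected =
  [ (λ ob → freeVertex⇒¬JM nonempty ob jm) , (λ ob → TwoBlocksGame.¬JM nonempty ob jm) ]′
    (disconnected⇒obstruction hypergraph disconnected)
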